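{- The path $P_3$ is the only tree $T$ of order $n\ge 3$ satisfying $C_{tr}(T)=n-1$.
   Context: A set $S\subseteq V$ is a total restrained dominating set (TRD-set) of $G=(V,E)$ if every vertex of $V\setminus S$ is adjacent to at least one vertex of $S$ and to at least one other vertex of $V\setminus S$, and every vertex of $S$ is adjacent to at least one other vertex of $S$. Two disjoint sets $X,Y\subseteq V$ form a total restrained coalition if neither is a TRD-set but $X\cup Y$ is a TRD-set. A trc-partition of $G$ is a partition $\Phi$ of $V$ such that no member of $\Phi$ is a TRD-set and each member forms a total restrained coalition with some other member of $\Phi$. $C_{tr}(G)$ is the maximum cardinality of a trc-partition of $G$. -}

module Defs where

open import Data.Nat using (ℕ; zero; suc; _+_; _≤_)
open import Data.Fin using (Fin; zero; suc; inject₁; fromℕ)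
open import Data.Bool using (Bool; true; false)
open import Data.Product using (Σ; ∃; _×_; _,_)
open import Data.Sum using (_⊎_)
open import Relation.Nullary using (¬_)
open import Relation.Binary.PropositionalEquality using (_≡_; _≢_)
open import Function.Definitions using (Injective)
open import Function.Bundles using (_⤖_; _⇔_; Bijection)

record Graph (n : ℕ) : Set where
  field
    adj    : Fin n → Fin n → Bool
    sym    : ∀ u v → adj u v ≡ adj v u
    irrefl : ∀ v → adj v v ≡ false

open Graph public

Edge : ∀ {n} → Graph n → Fin n → Fin n → Set
Edge G u v = adj G u v ≡ true

data Reach {n : ℕ} (G : Graph n) : Fin n → Fin n → Set where
  here : ∀ {v} → Reach G v v
  step : ∀ {u w v} → Edge G u w → Reach G w v → Reach G u v

Connected : ∀ {n} → Graph n → Set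
Connected G = ∀ u v → Reach G u v

record Cycle {n : ℕ} (G : Graph n) : Set where
  field
    m     : ℕ
    f     : Fin (3 + m) → Fin n
    inj   : Injective _≡_ _≡_ f
    edges : ∀ (i : Fin (2 + m)) → Edge G (f (inject₁ i)) (f (suc i))
    close : Edge G (f (fromℕ (2 + m))) (f zero)

Acyclic : ∀ {n} → Graph n → Set
Acyclic G = ¬ Cycle G

IsTree : ∀ {n} → Graph n → Set
IsTree G = Connected G × Acyclic G

VSet : ℕ → Set₁
VSet n = Fin n → Set

IsTRD : ∀ {n} → Graph n → VSet n → Set
IsTRD {n} G S =
  (∀ (v : Fin n) → ¬ S v →
     (∃ λ u → S u × Edge G v u) × (∃ λ w → ¬ S w × w ≢ v × Edge G v w))
  × (∀ (v : Fin n) → S v → ∃ λ u → S u × u ≢ v × Edge G v u)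

Member : ∀ {n k} → (Fin n → Fin k) → Fin k → VSet n
Member c i v = c v ≡ i

Union : ∀ {n} → VSet n → VSet n → VSet n
Union X Y v = X v ⊎ Y v

record TRCPartition {n : ℕ} (G : Graph n) (k : ℕ) : Set where
  field
    cls       : Fin n → Fin k
    nonempty  : ∀ (i : Fin k) → ∃ λ v → cls v ≡ i
    notTRD    : ∀ (i : Fin k) → ¬ IsTRD G (Member cls i)
    coalition : ∀ (i : Fin k) → ∃ λ j → j ≢ i ×
                  IsTRD G (Union (Member cls i) (Member cls j))

CtrIs : ∀ {n} → Graph n → ℕ → Set
CtrIs G m = TRCPartition G m × (∀ k → TRCPartition G k → k ≤ m)

P3adj : Fin 3 → Fin 3 → Bool
P3adj zero (suc zero) = true
P3adj (suc zero) zero = true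
P3adj (suc zero) (suc (suc zero)) = true
P3adj (suc (suc zero)) (suc zero) = true
P3adj _ _ = false

P3 : Graph 3
P3 = record { adj = P3adj ; sym = s ; irrefl = r }
  where
  s : ∀ u v → P3adj u v ≡ P3adj v u
  s zero zero = _≡_.refl
  s zero (suc zero) = _≡_.refl
  s zero (suc (suc zero)) = _≡_.refl
  s (suc zero) zero = _≡_.refl
  s (suc zero) (suc zero) = _≡_.refl
  s (suc zero) (suc (suc zero)) = _≡_.refl
  s (suc (suc zero)) zero = _≡_.refl
  s (suc (suc zero)) (suc zero) = _≡_.refl
  s (suc (suc zero)) (suc (suc zero)) = _≡_.refl
  r : ∀ v → P3adj v v ≡ false
  r zero = _≡_.refl
  r (suc zero) = _≡_.refl
  r (suc (suc zero)) = _≡_.refl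

_≅_ : ∀ {n m} → Graph n → Graph m → Set
_≅_ {n} {m} G H = Σ (Fin n ⤖ Fin m) λ φ →
  ∀ u v → adj G u v ≡ adj H (Bijection.to φ u) (Bijection.to φ v)

-- A total restrained dominating set S of a forest that misses a vertex v has at
-- least four elements: v has a neighbour s₁ ∈ S and a neighbour w ∉ S, w has a
-- neighbour s₂ ∈ S, and s₁, s₂ have neighbours t₁, t₂ in S; any coincidence or
-- adjacency among s₁, s₂, t₁, t₂ closes a cycle of length 3, 4 or 5 through v
-- and w.  In a trc-partition with k ≥ 3 members, the coalition V₀ ∪ Vⱼ of the
-- first member misses the k - 2 other members, so n ≥ 4 + (k - 2) = k + 2.  Hence a
-- tree with n ≥ 4 vertices has C_tr ≤ n - 2, and the only tree on three
-- vertices, P₃, has C_tr = 2.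
module Submission where

open import Defs
open import Data.Nat using (ℕ; _≤_; _∸_)
open import Function.Bundles using (_⇔_)

open import Data.Bool as Bool using (true; false)
open import Data.Empty using (⊥-elim)
open import Data.Fin using (Fin; suc; _≟_; splitAt; join; punchIn)
open import Data.Fin.Patterns using (0F; 1F; 2F; 3F)
open import Data.Fin.Permutation.Components using (transpose; transpose-inverse)
open import Data.Fin.Properties using (injective⇒≤; join-splitAt; suc-injective; punchIn-injective; punchInᵢ≢i)
open import Data.Nat using (suc; _+_; z≤n; s≤s; s≤s⁻¹)
open import Data.Nat.Properties using (≤-refl; m≤n⇒m≤1+n; <-irrefl)
open import Data.Product using (∃; _×_; _,_; proj₁; proj₂)
open import Data.Sum using (_⊎_; inj₁; inj₂; [_,_])
open import Data.Vec.Functional using ([]; _∷_; _++_)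
open import Function.Base using (id; _∘_)
open import Function.Bundles using (Bijection; Inverse; mk⇔; mk↔ₛ′)
open import Function.Definitions using (Injective)
open import Function.Properties.Bijection using (⤖⇒↔)
open import Function.Properties.Inverse using (↔⇒⤖)
open import Relation.Nullary using (¬_; yes; no)
open import Relation.Binary.PropositionalEquality
  using (_≡_; _≢_; refl; trans; cong; subst; ≢-sym) renaming (sym to ≡-sym)

module _ {a} {A : Set a} where

  injective-[] : Injective _≡_ _≡_ ([] {A = A})
  injective-[] {()}

  injective-∷ : ∀ {m} {x : A} {xs : Fin m → A} →
                (∀ i → xs i ≢ x) → Injective _≡_ _≡_ xs → Injective _≡_ _≡_ (x ∷ xs)
  injective-∷ fresh inj {0F}    {0F}    _  = refl
  injective-∷ fresh inj {0F}    {suc j} eq = ⊥-elim (fresh j (≡-sym eq))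
  injective-∷ fresh inj {suc i} {0F}    eq = ⊥-elim (fresh i eq)
  injective-∷ fresh inj {suc i} {suc j} eq = cong suc (inj eq)

  injective-++ : ∀ {m n} {xs : Fin m → A} {ys : Fin n → A} →
                 Injective _≡_ _≡_ xs → Injective _≡_ _≡_ ys → (∀ i j → xs i ≢ ys j) →
                 Injective _≡_ _≡_ (xs ++ ys)
  injective-++ {m} {n} {xs} {ys} inj-xs inj-ys apart {i} {j} eq =
    trans (≡-sym (join-splitAt m n i))
          (trans (cong (join m n) (injective-[,] (splitAt m i) (splitAt m j) eq))
                 (join-splitAt m n j))
    where
    injective-[,] : ∀ p q → [ xs , ys ] p ≡ [ xs , ys ] q → p ≡ q
    injective-[,] (inj₁ x) (inj₁ y) e = cong inj₁ (inj-xs e)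
    injective-[,] (inj₁ x) (inj₂ y) e = ⊥-elim (apart x y e)
    injective-[,] (inj₂ x) (inj₁ y) e = ⊥-elim (apart y x (≡-sym e))
    injective-[,] (inj₂ x) (inj₂ y) e = cong inj₂ (inj-ys e)

  distinct₃ : ∀ {x y z : A} → x ≢ y → x ≢ z → y ≢ z → Injective _≡_ _≡_ (x ∷ y ∷ z ∷ [])
  distinct₃ x≢y x≢z y≢z =
    injective-∷ (λ { 0F → ≢-sym x≢y ; 1F → ≢-sym x≢z })
      (injective-∷ (λ { 0F → ≢-sym y≢z }) (injective-∷ (λ ()) injective-[]))

  distinct₄ : ∀ {x y z u : A} → x ≢ y → x ≢ z → x ≢ u → y ≢ z → y ≢ u → z ≢ u →
              Injective _≡_ _≡_ (x ∷ y ∷ z ∷ u ∷ [])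
  distinct₄ x≢y x≢z x≢u y≢z y≢u z≢u =
    injective-∷ (λ { 0F → ≢-sym x≢y ; 1F → ≢-sym x≢z ; 2F → ≢-sym x≢u })
      (distinct₃ y≢z y≢u z≢u)

  distinct₅ : ∀ {x y z u t : A} → x ≢ y → x ≢ z → x ≢ u → x ≢ t →
              y ≢ z → y ≢ u → y ≢ t → z ≢ u → z ≢ t → u ≢ t →
              Injective _≡_ _≡_ (x ∷ y ∷ z ∷ u ∷ t ∷ [])
  distinct₅ x≢y x≢z x≢u x≢t y≢z y≢u y≢t z≢u z≢t u≢t =
    injective-∷ (λ { 0F → ≢-sym x≢y ; 1F → ≢-sym x≢z ; 2F → ≢-sym x≢u ; 3F → ≢-sym x≢t })
      (distinct₄ y≢z y≢u y≢t z≢u z≢t u≢t)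

module _ {n} (G : Graph n) where

  Edge-sym : ∀ {u v} → Edge G u v → Edge G v u
  Edge-sym {u} {v} e = trans (sym G v u) e

  ≁-≢ : ∀ {u v w} → ¬ Edge G u v → Edge G u w → v ≢ w
  ≁-≢ u≁v u-w refl = u≁v u-w

  triangle : ∀ {a b c} → Injective _≡_ _≡_ (a ∷ b ∷ c ∷ []) →
             Edge G a b → Edge G b c → Edge G c a → Cycle G
  triangle inj ab bc ca = record
    { m = 0 ; f = _ ; inj = inj ; edges = λ { 0F → ab ; 1F → bc } ; close = ca }

  square : ∀ {a b c d} → Injective _≡_ _≡_ (a ∷ b ∷ c ∷ d ∷ []) →
           Edge G a b → Edge G b c → Edge G c d → Edge G d a → Cycle G
  square inj ab bc cd da = record
    { m = 1 ; f = _ ; inj = inj ; edges = λ { 0F → ab ; 1F → bc ; 2F → cd } ; close = da }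

  pentagon : ∀ {a b c d e} → Injective _≡_ _≡_ (a ∷ b ∷ c ∷ d ∷ e ∷ []) →
             Edge G a b → Edge G b c → Edge G c d → Edge G d e → Edge G e a → Cycle G
  pentagon inj ab bc cd de ea = record
    { m = 2 ; f = _ ; inj = inj
    ; edges = λ { 0F → ab ; 1F → bc ; 2F → cd ; 3F → de } ; close = ea }

AtLeast : ∀ {n} → ℕ → VSet n → Set
AtLeast {n} m S = ∃ λ (f : Fin m → Fin n) → Injective _≡_ _≡_ f × (∀ i → S (f i))

AtLeast-∁-+ : ∀ {n a b} {S : VSet n} → AtLeast a S → AtLeast b (¬_ ∘ S) → a + b ≤ n
AtLeast-∁-+ {S = S} (f , inj-f , f∈S) (g , inj-g , g∉S) =
  injective⇒≤ (injective-++ inj-f inj-g λ i j f≡g → g∉S j (subst S f≡g (f∈S i)))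

∉∈⇒≢ : ∀ {n} {S : VSet n} {u v} → ¬ S u → S v → u ≢ v
∉∈⇒≢ u∉S v∈S refl = u∉S v∈S

acyclic-TRD-AtLeast4 : ∀ {n} {G : Graph n} {S : VSet n} {v} →
                       Acyclic G → IsTRD G S → ¬ S v → AtLeast 4 S
acyclic-TRD-AtLeast4 {G = G} {S} {v} acyc (dom , tot) v∉S
  with dom v v∉S
... | (s₁ , s₁∈S , v-s₁) , (w , w∉S , w≢v , v-w)
  with proj₁ (dom w w∉S)
... | s₂ , s₂∈S , w-s₂
  with s₁ ≟ s₂
... | yes refl = ⊥-elim (acyc (triangle G
        (distinct₃ (≢-sym w≢v) (∉∈⇒≢ v∉S s₁∈S) (∉∈⇒≢ w∉S s₁∈S))
        v-w w-s₂ (Edge-sym G v-s₁)))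
... | no s₁≢s₂
  with adj G s₂ s₁ Bool.≟ true
... | yes s₂-s₁ = ⊥-elim (acyc (square G
        (distinct₄ (≢-sym w≢v) (∉∈⇒≢ v∉S s₂∈S) (∉∈⇒≢ v∉S s₁∈S)
                   (∉∈⇒≢ w∉S s₂∈S) (∉∈⇒≢ w∉S s₁∈S) (≢-sym s₁≢s₂))
        v-w w-s₂ s₂-s₁ (Edge-sym G v-s₁)))
... | no s₂≁s₁
  with tot s₁ s₁∈S | tot s₂ s₂∈S
... | t₁ , t₁∈S , t₁≢s₁ , s₁-t₁ | t₂ , t₂∈S , t₂≢s₂ , s₂-t₂
  with t₁ ≟ t₂
... | yes refl = ⊥-elim (acyc (pentagon G
        (distinct₅ (≢-sym w≢v) (∉∈⇒≢ v∉S s₂∈S) (∉∈⇒≢ v∉S t₁∈S) (∉∈⇒≢ v∉S s₁∈S)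
                   (∉∈⇒≢ w∉S s₂∈S) (∉∈⇒≢ w∉S t₁∈S) (∉∈⇒≢ w∉S s₁∈S)
                   (≁-≢ G (s₂≁s₁ ∘ Edge-sym G) s₁-t₁) (≢-sym s₁≢s₂) t₁≢s₁)
        v-w w-s₂ s₂-t₂ (Edge-sym G s₁-t₁) (Edge-sym G v-s₁)))
... | no t₁≢t₂ =
  _ , distinct₄ s₁≢s₂ (≢-sym t₁≢s₁) (≁-≢ G s₂≁s₁ s₂-t₂)
                (≁-≢ G (s₂≁s₁ ∘ Edge-sym G) s₁-t₁) (≢-sym t₂≢s₂) t₁≢t₂ ,
  λ { 0F → s₁∈S ; 1F → s₂∈S ; 2F → t₁∈S ; 3F → t₂∈S }

acyclic-TRCPartition-bound : ∀ {n k} {G : Graph n} →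
                             Acyclic G → TRCPartition G k → k ≤ 2 ⊎ 2 + k ≤ n
acyclic-TRCPartition-bound {k = 0} _ _ = inj₁ z≤n
acyclic-TRCPartition-bound {k = 1} _ _ = inj₁ (s≤s z≤n)
acyclic-TRCPartition-bound {k = 2} _ _ = inj₁ ≤-refl
acyclic-TRCPartition-bound {n} {suc (suc (suc k))} acyc P
  with TRCPartition.coalition P 0F
... | 0F    , 0≢0 , _     = ⊥-elim (0≢0 refl)
... | suc j , _   , U-TRD =
  inj₂ (AtLeast-∁-+ {S = U} (acyclic-TRD-AtLeast4 acyc U-TRD (outside∉U 0F))
                    (outside , outside-injective , outside∉U))
  where
  open TRCPartition P
  U : VSet n
  U = Union (Member cls 0F) (Member cls (suc j))

  rep : Fin (3 + k) → Fin n
  rep i = proj₁ (nonempty i)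

  rep∈ : ∀ i → Member cls i (rep i)
  rep∈ i = proj₂ (nonempty i)

  rep-class : ∀ {i i′} → Member cls i′ (rep i) → i ≡ i′
  rep-class {i} rep∈i′ = trans (≡-sym (rep∈ i)) rep∈i′

  -- Representatives of the k - 2 members other than the coalition V₀ ∪ Vⱼ.
  outside : Fin (suc k) → Fin n
  outside i = rep (suc (punchIn j i))

  outside-injective : Injective _≡_ _≡_ outside
  outside-injective {i} {i′} eq =
    punchIn-injective j i i′ (suc-injective (rep-class (subst (Member cls _) (≡-sym eq) (rep∈ _))))

  outside∉U : ∀ i → ¬ U (outside i)
  outside∉U i (inj₁ ∈V₀) with rep-class ∈V₀
  ... | ()
  outside∉U i (inj₂ ∈Vⱼ) = punchInᵢ≢i j i (suc-injective (rep-class ∈Vⱼ))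

module _ {n m} {G : Graph n} {H : Graph m} (G≅H : G ≅ H) where
  private
    open Inverse (⤖⇒↔ (proj₁ G≅H))
      using (to; from) renaming (strictlyInverseˡ to to∘from; strictlyInverseʳ to from∘to)

    preserves : ∀ u v → adj G u v ≡ adj H (to u) (to v)
    preserves = proj₂ G≅H

    Edge-to : ∀ {u v} → Edge G u v → Edge H (to u) (to v)
    Edge-to {u} {v} e = trans (≡-sym (preserves u v)) e

    Edge-from : ∀ {u y} → Edge H (to u) y → Edge G u (from y)
    Edge-from {u} {y} e = trans (preserves u (from y)) (subst (Edge H (to u)) (≡-sym (to∘from y)) e)

    from-≢ : ∀ {y v} → y ≢ to v → from y ≢ v
    from-≢ {y} y≢ refl = y≢ (≡-sym (to∘from y))

    to-≢ : ∀ {w x} → w ≢ from x → to w ≢ x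
    to-≢ {w} w≢ refl = w≢ (≡-sym (from∘to w))

  IsTRD-pullback : ∀ {S : VSet m} → IsTRD H S → IsTRD G (S ∘ to)
  IsTRD-pullback {S} (dom , tot) = dom′ , tot′
    where
    dom′ : ∀ v → ¬ S (to v) → _
    dom′ v v∉S with dom (to v) v∉S
    ... | (x , x∈S , v-x) , (y , y∉S , y≢v , v-y) =
      (from x , subst S (≡-sym (to∘from x)) x∈S , Edge-from v-x) ,
      (from y , y∉S ∘ subst S (to∘from y) , from-≢ y≢v , Edge-from v-y)
    tot′ : ∀ v → S (to v) → _
    tot′ v v∈S with tot (to v) v∈S
    ... | x , x∈S , x≢v , v-x = from x , subst S (≡-sym (to∘from x)) x∈S , from-≢ x≢v , Edge-from v-x

  IsTRD-pushforward : ∀ {S : VSet m} → IsTRD G (S ∘ to) → IsTRD H S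
  IsTRD-pushforward {S} (dom , tot) = dom′ , tot′
    where
    at : ∀ {x y} → Edge G (from x) y → Edge H x (to y)
    at {x} e = subst (λ z → Edge H z _) (to∘from x) (Edge-to e)
    dom′ : ∀ x → ¬ S x → _
    dom′ x x∉S with dom (from x) (x∉S ∘ subst S (to∘from x))
    ... | (u , u∈S , x-u) , (w , w∉S , w≢x , x-w) = (to u , u∈S , at x-u) , (to w , w∉S , to-≢ w≢x , at x-w)
    tot′ : ∀ x → S x → _
    tot′ x x∈S with tot (from x) (subst S (≡-sym (to∘from x)) x∈S)
    ... | u , u∈S , u≢x , x-u = to u , u∈S , to-≢ u≢x , at x-u

  TRCPartition-≅ : ∀ {k} → TRCPartition H k → TRCPartition G k
  TRCPartition-≅ P = record
    { cls       = cls ∘ to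
    ; nonempty  = λ i → from (proj₁ (nonempty i)) , trans (cong cls (to∘from _)) (proj₂ (nonempty i))
    ; notTRD    = λ i → notTRD i ∘ IsTRD-pushforward
    ; coalition = λ i → let j , j≢i , trd = coalition i in j , j≢i , IsTRD-pullback trd
    }
    where open TRCPartition P

spanning-IsTRD : ∀ {n} {G : Graph n} {S : VSet n} →
                 (∀ v → S v) → (∀ v → ∃ λ u → u ≢ v × Edge G v u) → IsTRD G S
spanning-IsTRD all neighbour =
  (λ v v∉S → ⊥-elim (v∉S (all v))) ,
  (λ v _ → let u , u≢v , v-u = neighbour v in u , all u , u≢v , v-u)

P3-TRCPartition : TRCPartition P3 2
P3-TRCPartition = record
  { cls       = classes
  ; nonempty  = λ { 0F → 0F , refl ; 1F → 2F , refl }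
  ; notTRD    = notTRD
  ; coalition = coalition
  }
  where
  classes : Fin 3 → Fin 2
  classes 0F = 0F
  classes 1F = 0F
  classes 2F = 1F

  neighbour : ∀ v → ∃ λ u → u ≢ v × Edge P3 v u
  neighbour 0F = 1F , (λ ()) , refl
  neighbour 1F = 0F , (λ ()) , refl
  neighbour 2F = 1F , (λ ()) , refl

  -- The only neighbour of 2 is 1: it lies in {0, 1}, and there is none in {2}.
  notTRD : ∀ i → ¬ IsTRD P3 (Member classes i)
  notTRD 0F (dom , _) with proj₂ (dom 2F (λ ()))
  ... | 1F , 1∉ , _ = 1∉ refl
  ... | 2F , _ , 2≢2 , _ = 2≢2 refl
  notTRD 1F (_ , tot) with tot 2F refl
  ... | 2F , _ , 2≢2 , _ = 2≢2 refl

  coalition : ∀ i → ∃ λ j → j ≢ i × IsTRD P3 (Union (Member classes i) (Member classes j))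
  coalition 0F = 1F , (λ ()) ,
    spanning-IsTRD {G = P3} (λ { 0F → inj₁ refl ; 1F → inj₁ refl ; 2F → inj₂ refl }) neighbour
  coalition 1F = 0F , (λ ()) ,
    spanning-IsTRD {G = P3} (λ { 0F → inj₂ refl ; 1F → inj₂ refl ; 2F → inj₁ refl }) neighbour

relabel : ∀ {n m} → Graph m → (Fin n → Fin m) → Graph n
relabel H φ = record
  { adj    = λ u v → adj H (φ u) (φ v)
  ; sym    = λ u v → sym H (φ u) (φ v)
  ; irrefl = λ v → irrefl H (φ v) }

≅-relabel : ∀ {n} (G H : Graph n) (φ ψ : Fin n → Fin n) →
            (∀ x → φ (ψ x) ≡ x) → (∀ x → ψ (φ x) ≡ x) →
            (∀ u v → adj G u v ≡ adj (relabel H φ) u v) → G ≅ H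
≅-relabel G H φ ψ φ∘ψ ψ∘φ agree = ↔⇒⤖ (mk↔ₛ′ φ ψ φ∘ψ ψ∘φ) , agree

adj₃-agree : (G H : Graph 3) →
             adj G 0F 1F ≡ adj H 0F 1F → adj G 0F 2F ≡ adj H 0F 2F → adj G 1F 2F ≡ adj H 1F 2F →
             ∀ u v → adj G u v ≡ adj H u v
adj₃-agree G H e₀₁ e₀₂ e₁₂ = agree
  where
  diagonal : ∀ v → adj G v v ≡ adj H v v
  diagonal v = trans (irrefl G v) (≡-sym (irrefl H v))
  flipped : ∀ {u v} → adj G u v ≡ adj H u v → adj G v u ≡ adj H v u
  flipped {u} {v} e = trans (sym G v u) (trans e (sym H u v))
  agree : ∀ u v → adj G u v ≡ adj H u v
  agree 0F 0F = diagonal 0F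
  agree 0F 1F = e₀₁
  agree 0F 2F = e₀₂
  agree 1F 0F = flipped e₀₁
  agree 1F 1F = diagonal 1F
  agree 1F 2F = e₁₂
  agree 2F 0F = flipped e₀₂
  agree 2F 1F = flipped e₁₂
  agree 2F 2F = diagonal 2F

isolated⇒¬Connected : ∀ {n} {G : Graph n} {u v} → u ≢ v → (∀ w → adj G v w ≡ false) → ¬ Connected G
isolated⇒¬Connected {u = u} {v} u≢v isolated connected with connected v u
... | here = u≢v refl
... | step {w = w} v-w _ with trans (≡-sym v-w) (isolated w)
...   | ()

tree₃≅P3 : (T : Graph 3) → IsTree T → T ≅ P3
tree₃≅P3 T (connected , acyc) with adj T 0F 1F in e₀₁ | adj T 0F 2F in e₀₂ | adj T 1F 2F in e₁₂
... | true  | true  | true  =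
  ⊥-elim (acyc (triangle T (distinct₃ (λ ()) (λ ()) (λ ())) e₀₁ e₁₂ (Edge-sym T e₀₂)))
... | true  | true  | false =
  ≅-relabel T P3 (transpose 0F 1F) (transpose 1F 0F)
    (λ _ → transpose-inverse 0F 1F) (λ _ → transpose-inverse 1F 0F)
    (adj₃-agree T (relabel P3 (transpose 0F 1F)) e₀₁ e₀₂ e₁₂)
... | true  | false | true  =
  ≅-relabel T P3 id id (λ _ → refl) (λ _ → refl) (adj₃-agree T P3 e₀₁ e₀₂ e₁₂)
... | false | true  | true  =
  ≅-relabel T P3 (transpose 1F 2F) (transpose 2F 1F)
    (λ _ → transpose-inverse 1F 2F) (λ _ → transpose-inverse 2F 1F)
    (adj₃-agree T (relabel P3 (transpose 1F 2F)) e₀₁ e₀₂ e₁₂)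
... | true  | false | false = ⊥-elim (isolated⇒¬Connected {u = 0F} (λ ())
  (λ { 0F → trans (sym T 2F 0F) e₀₂ ; 1F → trans (sym T 2F 1F) e₁₂ ; 2F → irrefl T 2F }) connected)
... | false | true  | false = ⊥-elim (isolated⇒¬Connected {u = 0F} (λ ())
  (λ { 0F → trans (sym T 1F 0F) e₀₁ ; 1F → irrefl T 1F ; 2F → e₁₂ }) connected)
... | false | false | _     = ⊥-elim (isolated⇒¬Connected {u = 1F} (λ ())
  (λ { 0F → irrefl T 0F ; 1F → e₀₁ ; 2F → e₀₂ }) connected)

theorem4p4 : ∀ (n : ℕ) → 3 ≤ n → (T : Graph n) → IsTree T →
    (CtrIs T (n ∸ 1) ⇔ T ≅ P3)
theorem4p4 0 () _ _
theorem4p4 1 (s≤s ()) _ _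
theorem4p4 2 (s≤s (s≤s ())) _ _
theorem4p4 3 _ T tree@(_ , acyc) = mk⇔ (λ _ → tree₃≅P3 T tree) λ T≅P3 →
  TRCPartition-≅ T≅P3 P3-TRCPartition ,
  λ k P → [ id , (λ 2+k≤3 → m≤n⇒m≤1+n (s≤s⁻¹ (s≤s⁻¹ 2+k≤3))) ] (acyclic-TRCPartition-bound acyc P)
theorem4p4 (suc (suc (suc (suc m)))) _ T (_ , acyc) = mk⇔
  (λ (P , _) → ⊥-elim ([ (λ { (s≤s (s≤s ())) }) , <-irrefl refl ] (acyclic-TRCPartition-bound acyc P)))
  (λ (φ , _) → ⊥-elim (n≰3 (injective⇒≤ (Bijection.injective φ))))
  where
  n≰3 : ¬ (4 + m ≤ 3)
  n≰3 (s≤s (s≤s (s≤s ())))
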